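{- Let $G$ be a finite simple graph, $t\ge 2$ an integer, $x$ a simplicial vertex of $G$, and $C\subseteq V(G)$ with $x\in C$, $|C|=t-1$ and $G[C]$ connected. Then for every $y\in N_G(C)$, \[\mathrm{bight}(J_t(G))\ge |N_G(C)|+|N_G(y)\setminus N_G[C]|+\mathrm{bight}\big(J_t(G\setminus(N_G[C]\cup N_G[y]))\big).\]
   Context: A vertex is simplicial if its neighbourhood induces a complete graph. $G[W]$ is the induced subgraph on $W$; for $S\subseteq V(G)$, $G\setminus S$ is the induced subgraph on $V(G)\setminus S$. $N_G(C)=\{v\in V(G)\setminus C\mid \{v,u\}\in E(G)\text{ for some }u\in C\}$, $N_G[C]=N_G(C)\cup C$, $N_G[y]=N_G(y)\cup\{y\}$. For a graph $H$, with vertices viewed as variables of a polynomial ring over a field and $\mathbf x_F=\prod_{v\in F}v$, $J_t(H)=\langle \mathbf x_A\mid A\subseteq V(H),\ |A|=t,\ H[A]\text{ connected}\rangle$. $\mathrm{bight}(I)$ is the maximum height of a minimal prime of $I$ (for squarefree monomial ideals, the maximum size of a minimal vertex cover of the hypergraph of supports of the minimal generators), with $\mathrm{bight}(\langle 0\rangle)=0$. -}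

module Defs where

open import Data.Bool using (Bool; true; false; not; _∧_; _∨_)
open import Data.Nat using (ℕ; zero; suc; _≤_)
open import Data.Fin using (Fin; zero; suc)
open import Data.Fin.Subset using (Subset; _∈_; _⊆_; ∣_∣; ∁; _∪_; _∩_; ⁅_⁆; ⊤)
open import Data.Vec using (lookup; tabulate)
open import Data.Product using (Σ; ∃; _×_; _,_)
open import Relation.Binary.PropositionalEquality using (_≡_; _≢_)

record Graph (n : ℕ) : Set where
  field
    adj   : Fin n → Fin n → Bool
    sym   : ∀ u v → adj u v ≡ adj v u
    irrefl : ∀ v → adj v v ≡ false
open Graph public

anyFin : ∀ {n} → (Fin n → Bool) → Bool
anyFin {zero}  f = false
anyFin {suc n} f = f zero ∨ anyFin (λ i → f (suc i))

N : ∀ {n} → Graph n → Subset n → Subset n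
N G C = tabulate λ v → not (lookup C v) ∧ anyFin (λ u → lookup C u ∧ adj G v u)

N[_] : ∀ {n} → Graph n → Subset n → Subset n
N[ G ] C = N G C ∪ C

Simplicial : ∀ {n} → Graph n → Fin n → Set
Simplicial G x = ∀ u v → adj G x u ≡ true → adj G x v ≡ true → u ≢ v → adj G u v ≡ true

data Reach {n} (G : Graph n) (A : Subset n) : Fin n → Fin n → Set where
  here : ∀ {u} → u ∈ A → Reach G A u u
  step : ∀ {u w v} → u ∈ A → adj G u w ≡ true → Reach G A w v → Reach G A u v

Connected : ∀ {n} → Graph n → Subset n → Set
Connected G A = ∀ u v → u ∈ A → v ∈ A → Reach G A u v

-- Supports of the generators of J_t(G[W]) (with W the vertex set of the
-- induced subgraph): A ⊆ W, |A| = t, G[A] connected.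
GenSupp : ∀ {n} → Graph n → ℕ → Subset n → Subset n → Set
GenSupp G t W A = A ⊆ W × ∣ A ∣ ≡ t × Connected G A

-- Supports of the minimal generators (x_B ∣ x_A iff B ⊆ A).
MinGenSupp : ∀ {n} → Graph n → ℕ → Subset n → Subset n → Set
MinGenSupp G t W A = GenSupp G t W A × (∀ B → GenSupp G t W B → B ⊆ A → B ≡ A)

-- Vertex covers (sets of variables of the ring of G[W]) of the hypergraph
-- of supports of minimal generators of J_t(G[W]).
Cover : ∀ {n} → Graph n → ℕ → Subset n → Subset n → Set
Cover G t W M = M ⊆ W × (∀ A → MinGenSupp G t W A → ∃ λ v → v ∈ A × v ∈ M)

MinCover : ∀ {n} → Graph n → ℕ → Subset n → Subset n → Set
MinCover G t W M = Cover G t W M × (∀ M′ → Cover G t W M′ → M′ ⊆ M → M′ ≡ M)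

IsMax : (ℕ → Set) → ℕ → Set
IsMax P b = P b × (∀ k → P k → k ≤ b)

-- Bight G t W b : b = bight(J_t(G[W])), the maximum size of a minimal
-- vertex cover of the hypergraph of supports of minimal generators.
-- (For J_t = 0 the only minimal cover is ∅, so b = 0, matching bight(0) = 0.)
Bight : ∀ {n} → Graph n → ℕ → Subset n → ℕ → Set
Bight G t W b = IsMax (λ k → ∃ λ M → MinCover G t W M × ∣ M ∣ ≡ k) b

-- Every minimal generator of J_t(G) has exactly t vertices, so a cover M is
-- minimal as soon as each of its vertices v is the only vertex of M in some
-- generator. Take M = (N(C) − y) ∪ {x} ∪ (N(y) ∖ N[C]) ∪ M₂ with M₂ a minimal
-- cover of J_t(G ∖ (N[C] ∪ N[y])) of maximal size; as x replaces y, its size is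
-- the right-hand side. A generator avoiding M either lies in G ∖ (N[C] ∪ N[y]) and meets M₂,
-- or meets C ∪ {y} and is then trapped in (C ∪ {y}) − x, which has only t − 1
-- vertices. The private generators are C ∪ {y} for x, ((C ∪ {y}) ∪ {v}) − x for
-- a neighbour v of C ∪ {y} (connected because x is simplicial), and for
-- v ∈ M₂ minimality of M₂ applied to the restriction of a smaller cover.
module Submission where

open import Data.Empty using (⊥; ⊥-elim)
open import Data.Bool using (Bool; true; false; not; _∧_)
open import Data.Bool.Properties using (∨-zeroʳ; ∧-conicalˡ; ∧-conicalʳ; ¬-not)
open import Data.Fin using (Fin; zero; suc; _≟_)
open import Data.Fin.Subset using (Subset; _∈_; _∉_; _⊆_; ∣_∣; ∁; _∪_; _∩_; _─_; _-_; ⁅_⁆; ⊤)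
open import Data.Fin.Subset.Properties
open import Data.Nat using (ℕ; suc; _+_; _∸_; _≤_; _<_; s≤s; z≤n)
open import Data.Nat.Properties using (≤-trans; ≤-reflexive; ≤-<-trans; <⇒≢; <⇒≱; +-suc; +-comm; m∸n+n≡m; suc-injective)
open import Data.Product using (∃; _×_; _,_; proj₁; proj₂)
open import Data.Sum using (_⊎_; inj₁; inj₂; [_,_]′)
open import Data.Vec using (_∷_; []; lookup; here; there)
open import Data.Vec.Properties using ([]=⇒lookup; lookup⇒[]=; lookup∘tabulate)
open import Function using (_∘_)
open import Relation.Nullary using (yes; no; contradiction)
open import Relation.Binary.PropositionalEquality
  using (_≡_; _≢_; refl; trans; cong; cong₂; subst; module ≡-Reasoning)
  renaming (sym to ≡-sym)
open import Defs hiding (sym)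

x∈p─q⇒x∉q : ∀ {n} (p q : Subset n) {i} → i ∈ p ─ q → i ∉ q
x∈p─q⇒x∉q (_ ∷ p) (true  ∷ q) {zero} ()
x∈p─q⇒x∉q (_ ∷ p) (false ∷ q) {zero} _ ()
x∈p─q⇒x∉q (_ ∷ p) (_ ∷ q) {suc i} (there i∈p─q) (there i∈q) = x∈p─q⇒x∉q p q i∈p─q i∈q

∣p∪q∣≡∣p∣+∣q∣ : ∀ {n} (p q : Subset n) → (∀ {i} → i ∈ p → i ∉ q) →
                ∣ p ∪ q ∣ ≡ ∣ p ∣ + ∣ q ∣
∣p∪q∣≡∣p∣+∣q∣ []          []          _        = refl
∣p∪q∣≡∣p∣+∣q∣ (true  ∷ p) (true  ∷ q) disjoint = contradiction here (disjoint here)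
∣p∪q∣≡∣p∣+∣q∣ (true  ∷ p) (false ∷ q) disjoint =
  cong suc (∣p∪q∣≡∣p∣+∣q∣ p q (λ i∈p i∈q → disjoint (there i∈p) (there i∈q)))
∣p∪q∣≡∣p∣+∣q∣ (false ∷ p) (true  ∷ q) disjoint =
  trans (cong suc (∣p∪q∣≡∣p∣+∣q∣ p q (λ i∈p i∈q → disjoint (there i∈p) (there i∈q))))
        (≡-sym (+-suc ∣ p ∣ ∣ q ∣))
∣p∪q∣≡∣p∣+∣q∣ (false ∷ p) (false ∷ q) disjoint =
  ∣p∪q∣≡∣p∣+∣q∣ p q (λ i∈p i∈q → disjoint (there i∈p) (there i∈q))

x∈p⇒suc∣p-x∣≡∣p∣ : ∀ {n} (p : Subset n) {x} → x ∈ p → suc ∣ p - x ∣ ≡ ∣ p ∣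
x∈p⇒suc∣p-x∣≡∣p∣ (true  ∷ p) here        = cong (suc ∘ ∣_∣) (p─⊥≡p p)
x∈p⇒suc∣p-x∣≡∣p∣ (true  ∷ p) (there x∈p) = cong suc (x∈p⇒suc∣p-x∣≡∣p∣ p x∈p)
x∈p⇒suc∣p-x∣≡∣p∣ (false ∷ p) (there x∈p) = x∈p⇒suc∣p-x∣≡∣p∣ p x∈p

p⊆q∧∣q∣≤∣p∣⇒p≡q : ∀ {n} {p q : Subset n} → p ⊆ q → ∣ q ∣ ≤ ∣ p ∣ → p ≡ q
p⊆q∧∣q∣≤∣p∣⇒p≡q {p = p} {q} p⊆q ∣q∣≤∣p∣ = ⊆-antisym p⊆q q⊆p
  where
  q⊆p : q ⊆ p
  q⊆p {i} i∈q with i ∈? p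
  ... | yes i∈p = i∈p
  ... | no  i∉p = contradiction ∣q∣≤∣p∣ (<⇒≱ (≤-trans (s≤s (p⊆q⇒∣p∣≤∣q∣ p⊆q-i)) (x∈p⇒∣p-x∣<∣p∣ i∈q)))
    where
    p⊆q-i : p ⊆ q - i
    p⊆q-i j∈p = x∈p∧x≢y⇒x∈p-y (p⊆q j∈p) (λ { refl → i∉p j∈p })

anyFin⁺ : ∀ {n} (f : Fin n → Bool) i → f i ≡ true → anyFin f ≡ true
anyFin⁺ f zero    fi≡true rewrite fi≡true = refl
anyFin⁺ f (suc i) fi≡true rewrite anyFin⁺ (f ∘ suc) i fi≡true = ∨-zeroʳ (f zero)

anyFin⁻ : ∀ {n} (f : Fin n → Bool) → anyFin f ≡ true → ∃ λ i → f i ≡ true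
anyFin⁻ {suc n} f any≡true with f zero in f0≡
... | true  = zero , f0≡
... | false with anyFin⁻ (f ∘ suc) any≡true
...   | i , fi≡true = suc i , fi≡true

module _ {n} (G : Graph n) where

  ∈N⁺ : ∀ {C v u} → v ∉ C → u ∈ C → adj G v u ≡ true → v ∈ N G C
  ∈N⁺ {C} {v} {u} v∉C u∈C vu = lookup⇒[]= v (N G C) (begin
    lookup (N G C) v                                           ≡⟨ lookup∘tabulate _ v ⟩
    not (lookup C v) ∧ anyFin (λ w → lookup C w ∧ adj G v w)  ≡⟨ cong₂ (λ a b → not a ∧ b) v∉C′ any-true ⟩
    true                                                       ∎)
    where
    open ≡-Reasoning
    v∉C′ : lookup C v ≡ false
    v∉C′ = ¬-not (v∉C ∘ lookup⇒[]= v C)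
    any-true : anyFin (λ w → lookup C w ∧ adj G v w) ≡ true
    any-true = anyFin⁺ _ u (cong₂ _∧_ ([]=⇒lookup u∈C) vu)

  ∈N⁻ : ∀ C {v} → v ∈ N G C → v ∉ C × ∃ λ u → u ∈ C × adj G v u ≡ true
  ∈N⁻ C {v} v∈N = v∉C , u , lookup⇒[]= u C (∧-conicalˡ _ _ uvs) , ∧-conicalʳ _ _ uvs
    where
    entry : not (lookup C v) ∧ anyFin (λ w → lookup C w ∧ adj G v w) ≡ true
    entry = trans (≡-sym (lookup∘tabulate _ v)) ([]=⇒lookup v∈N)
    v∉C : v ∉ C
    v∉C v∈C with trans (cong not (≡-sym ([]=⇒lookup v∈C))) (∧-conicalˡ _ _ entry)
    ... | ()
    witness = anyFin⁻ _ (∧-conicalʳ _ _ entry)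
    u = proj₁ witness
    uvs = proj₂ witness

  ∈N[]⁺ : ∀ {C v u} → u ∈ C → adj G v u ≡ true → v ∈ N[ G ] C
  ∈N[]⁺ {C} {v} u∈C vu with v ∈? C
  ... | yes v∈C = x∈p∪q⁺ (inj₂ v∈C)
  ... | no  v∉C = x∈p∪q⁺ (inj₁ (∈N⁺ v∉C u∈C vu))

  Reach-start : ∀ {A u v} → Reach G A u v → u ∈ A
  Reach-start (here u∈A)     = u∈A
  Reach-start (step u∈A _ _) = u∈A

  Reach-trans : ∀ {A u v w} → Reach G A u v → Reach G A v w → Reach G A u w
  Reach-trans (here _)         r′ = r′
  Reach-trans (step u∈A uw r) r′ = step u∈A uw (Reach-trans r r′)

  Reach-sym : ∀ {A u v} → Reach G A u v → Reach G A v u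
  Reach-sym (here u∈A) = here u∈A
  Reach-sym (step {u} {w} u∈A uw r) =
    Reach-trans (Reach-sym r) (step (Reach-start r) (trans (Graph.sym G w u) uw) (here u∈A))

  Reach-mono : ∀ {A B u v} → A ⊆ B → Reach G A u v → Reach G B u v
  Reach-mono A⊆B (here u∈A)       = here (A⊆B u∈A)
  Reach-mono A⊆B (step u∈A uw r) = step (A⊆B u∈A) uw (Reach-mono A⊆B r)

  -- A walk through the simplicial vertex x enters and leaves it via two
  -- neighbours of x, which are adjacent (or equal), so x can be skipped.
  Reach-avoid-simplicial : ∀ {T x a b} → Simplicial G x → a ≢ x → b ≢ x →
                           Reach G T a b → Reach G (T - x) a b
  Reach-avoid-simplicial sx a≢x b≢x (here a∈T) = here (x∈p∧x≢y⇒x∈p-y a∈T a≢x)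
  Reach-avoid-simplicial {x = x} sx a≢x b≢x (step {w = w} a∈T aw r) with w ≟ x
  ... | no w≢x = step (x∈p∧x≢y⇒x∈p-y a∈T a≢x) aw (Reach-avoid-simplicial sx w≢x b≢x r)
  Reach-avoid-simplicial sx a≢x b≢x (step _ _ (here _)) | yes refl = contradiction refl b≢x
  Reach-avoid-simplicial {x = x} sx a≢x b≢x (step {u = a} a∈T ax (step {w = w} _ xw r)) | yes refl
    with w ≟ a
  ... | yes refl = Reach-avoid-simplicial sx a≢x b≢x r
  ... | no  w≢a  = step (x∈p∧x≢y⇒x∈p-y a∈T a≢x)
                        (sx a w (trans (Graph.sym G x a) ax) xw (w≢a ∘ ≡-sym))
                        (Reach-avoid-simplicial sx w≢x b≢x r)
    where
    w≢x : w ≢ x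
    w≢x refl with trans (≡-sym xw) (Graph.irrefl G x)
    ... | ()

  connected-via : ∀ {A c} → (∀ {a} → a ∈ A → Reach G A a c) → Connected G A
  connected-via to-c a b a∈A b∈A = Reach-trans (to-c a∈A) (Reach-sym (to-c b∈A))

  connected-∪-⁅⁆ : ∀ {A u v} → Connected G A → u ∈ A → adj G v u ≡ true →
                   Connected G (A ∪ ⁅ v ⁆)
  connected-∪-⁅⁆ {A} {u} {v} connA u∈A vu = connected-via to-u
    where
    A⊆A∪v : A ⊆ A ∪ ⁅ v ⁆
    A⊆A∪v = p⊆p∪q ⁅ v ⁆
    to-u : ∀ {a} → a ∈ A ∪ ⁅ v ⁆ → Reach G (A ∪ ⁅ v ⁆) a u
    to-u {a} a∈ with x∈p∪q⁻ A ⁅ v ⁆ a∈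
    ... | inj₁ a∈A = Reach-mono A⊆A∪v (connA a u a∈A u∈A)
    ... | inj₂ a∈v with x∈⁅y⁆⇒x≡y v a∈v
    ...   | refl = step a∈ vu (here (A⊆A∪v u∈A))

  connected-minus-simplicial : ∀ {T x} → Simplicial G x → Connected G T → Connected G (T - x)
  connected-minus-simplicial {T} {x} sx connT a b a∈ b∈ =
    Reach-avoid-simplicial sx (≢x a∈) (≢x b∈) (connT a b (p─q⊆p T ⁅ x ⁆ a∈) (p─q⊆p T ⁅ x ⁆ b∈))
    where
    ≢x : ∀ {a} → a ∈ T - x → a ≢ x
    ≢x a∈ refl = x∈p─q⇒x∉q T ⁅ x ⁆ a∈ (x∈⁅x⁆ x)

  connected-trapped : ∀ {A S B c} → Connected G A → c ∈ A → c ∈ S →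
                      (∀ {u w} → u ∈ S → adj G u w ≡ true → w ∈ S ⊎ w ∈ B) →
                      (∀ {w} → w ∈ A → w ∉ B) → A ⊆ S
  connected-trapped {A} {S} {B} {c} connA c∈A c∈S closed avoid a∈A = walk c∈S (connA _ _ c∈A a∈A)
    where
    walk : ∀ {u a} → u ∈ S → Reach G A u a → a ∈ S
    walk u∈S (here _) = u∈S
    walk u∈S (step _ uw r) = [ (λ w∈S → walk w∈S r) , (λ w∈B → contradiction w∈B (avoid (Reach-start r))) ]′
                               (closed u∈S uw)

  module _ (t : ℕ) where

    GenSupp⇒MinGenSupp : ∀ {W A} → GenSupp G t W A → MinGenSupp G t W A
    GenSupp⇒MinGenSupp gA@(_ , ∣A∣≡t , _) =
      gA , λ B (_ , ∣B∣≡t , _) B⊆A → p⊆q∧∣q∣≤∣p∣⇒p≡q B⊆A (≤-reflexive (trans ∣A∣≡t (≡-sym ∣B∣≡t)))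

    Cover-restrict : ∀ {V W M} → W ⊆ V → Cover G t V M → Cover G t W (M ∩ W)
    Cover-restrict {V} {W} {M} W⊆V (_ , covers) = p∩q⊆q M W , covers′
      where
      covers′ : ∀ A → MinGenSupp G t W A → ∃ λ v → v ∈ A × v ∈ M ∩ W
      covers′ A ((A⊆W , ∣A∣≡t , connA) , _) with covers A (GenSupp⇒MinGenSupp (W⊆V ∘ A⊆W , ∣A∣≡t , connA))
      ... | v , v∈A , v∈M = v , v∈A , x∈p∩q⁺ (v∈M , A⊆W v∈A)

    subcover-∋-private : ∀ {W M M′ A v} → Cover G t W M′ → M′ ⊆ M → GenSupp G t W A →
                         (∀ {w} → w ∈ A → w ∈ M → w ≡ v) → v ∈ M′
    subcover-∋-private (_ , covers) M′⊆M gA only-v with covers _ (GenSupp⇒MinGenSupp gA)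
    ... | w , w∈A , w∈M′ with only-v w∈A (M′⊆M w∈M′)
    ...   | refl = w∈M′

module LargeMinimalCover {n} (G : Graph n) (t : ℕ) (2≤t : 2 ≤ t)
    (x : Fin n) (sx : Simplicial G x)
    (C : Subset n) (x∈C : x ∈ C) (∣C∣≡t∸1 : ∣ C ∣ ≡ t ∸ 1) (connC : Connected G C)
    (y : Fin n) (y∈NC : y ∈ N G C)
    (M₂ : Subset n) (M₂-min : MinCover G t (∁ (N[ G ] C ∪ N[ G ] ⁅ y ⁆)) M₂) where

  Cy : Subset n
  Cy = C ∪ ⁅ y ⁆

  NCy : Subset n
  NCy = N[ G ] C ∪ N[ G ] ⁅ y ⁆

  W : Subset n
  W = ∁ NCy

  Y : Subset n
  Y = N G ⁅ y ⁆ ∩ ∁ (N[ G ] C)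

  P : Subset n
  P = (N G C - y) ∪ ⁅ x ⁆

  M : Subset n
  M = (P ∪ Y) ∪ M₂

  M₂-cover : Cover G t W M₂
  M₂-cover = proj₁ M₂-min

  y∉C : y ∉ C
  y∉C = proj₁ (∈N⁻ G C y∈NC)

  x∈Cy : x ∈ Cy
  x∈Cy = x∈p∪q⁺ (inj₁ x∈C)

  ∉Cy : ∀ {v} → v ∉ C → v ∉ ⁅ y ⁆ → v ∉ Cy
  ∉Cy v∉C v∉y = [ v∉C , v∉y ]′ ∘ x∈p∪q⁻ C ⁅ y ⁆

  ∣Cy∣≡t : ∣ Cy ∣ ≡ t
  ∣Cy∣≡t = begin
    ∣ C ∪ ⁅ y ⁆ ∣     ≡⟨ ∣p∪q∣≡∣p∣+∣q∣ C ⁅ y ⁆ C-disjoint-y ⟩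
    ∣ C ∣ + ∣ ⁅ y ⁆ ∣ ≡⟨ cong₂ _+_ ∣C∣≡t∸1 (∣⁅x⁆∣≡1 y) ⟩
    t ∸ 1 + 1         ≡⟨ m∸n+n≡m (≤-trans (s≤s z≤n) 2≤t) ⟩
    t                 ∎
    where
    open ≡-Reasoning
    C-disjoint-y : ∀ {c} → c ∈ C → c ∉ ⁅ y ⁆
    C-disjoint-y c∈C c∈y = y∉C (subst (_∈ C) (x∈⁅y⁆⇒x≡y y c∈y) c∈C)

  connCy : Connected G Cy
  connCy = connected-∪-⁅⁆ G connC u∈C yu
    where
    u∈C = proj₁ (proj₂ (proj₂ (∈N⁻ G C y∈NC)))
    yu  = proj₂ (proj₂ (proj₂ (∈N⁻ G C y∈NC)))

  Cy⊆NCy : Cy ⊆ NCy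
  Cy⊆NCy v∈Cy = [ (λ v∈C → x∈p∪q⁺ (inj₁ (x∈p∪q⁺ (inj₂ v∈C))))
                , (λ v∈y → x∈p∪q⁺ (inj₂ (x∈p∪q⁺ (inj₂ v∈y)))) ]′ (x∈p∪q⁻ C ⁅ y ⁆ v∈Cy)

  adj-Cy⇒∈NCy : ∀ {u v} → u ∈ Cy → adj G v u ≡ true → v ∈ NCy
  adj-Cy⇒∈NCy u∈Cy vu = [ (λ u∈C → x∈p∪q⁺ (inj₁ (∈N[]⁺ G u∈C vu)))
                        , (λ u∈y → x∈p∪q⁺ (inj₂ (∈N[]⁺ G u∈y vu))) ]′ (x∈p∪q⁻ C ⁅ y ⁆ u∈Cy)

  P⊆N[C] : P ⊆ N[ G ] C
  P⊆N[C] v∈P with x∈p∪q⁻ (N G C - y) ⁅ x ⁆ v∈P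
  ... | inj₁ v∈NC-y = x∈p∪q⁺ (inj₁ (p─q⊆p (N G C) ⁅ y ⁆ v∈NC-y))
  ... | inj₂ v∈x rewrite x∈⁅y⁆⇒x≡y x v∈x = x∈p∪q⁺ (inj₂ x∈C)

  P∪Y⊆NCy : P ∪ Y ⊆ NCy
  P∪Y⊆NCy v∈P∪Y = [ x∈p∪q⁺ ∘ inj₁ ∘ P⊆N[C] , x∈p∪q⁺ ∘ inj₂ ∘ x∈p∪q⁺ ∘ inj₁ ∘ proj₁ ∘ x∈p∩q⁻ _ _ ]′
                    (x∈p∪q⁻ P Y v∈P∪Y)

  NCy-disjoint-M₂ : ∀ {v} → v ∈ NCy → v ∉ M₂
  NCy-disjoint-M₂ v∈NCy v∈M₂ = x∈∁p⇒x∉p (proj₁ M₂-cover v∈M₂) v∈NCy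

  x∈M : x ∈ M
  x∈M = x∈p∪q⁺ (inj₁ (x∈p∪q⁺ (inj₁ (x∈p∪q⁺ (inj₂ (x∈⁅x⁆ x))))))

  neighbour⇒∈M : ∀ {u v} → v ∉ Cy → u ∈ Cy → adj G v u ≡ true → v ∈ M
  neighbour⇒∈M {u} {v} v∉Cy u∈Cy vu with v ∈? N G C
  ... | yes v∈NC = x∈p∪q⁺ (inj₁ (x∈p∪q⁺ (inj₁ (x∈p∪q⁺ (inj₁ (x∈p∧x≢y⇒x∈p-y v∈NC v≢y))))))
    where
    v≢y : v ≢ y
    v≢y refl = v∉Cy (x∈p∪q⁺ (inj₂ (x∈⁅x⁆ y)))
  ... | no v∉NC with x∈p∪q⁻ C ⁅ y ⁆ u∈Cy
  ...   | inj₁ u∈C = contradiction (∈N⁺ G (v∉Cy ∘ x∈p∪q⁺ ∘ inj₁) u∈C vu) v∉NC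
  ...   | inj₂ u∈y = x∈p∪q⁺ (inj₁ (x∈p∪q⁺ (inj₂ (x∈p∩q⁺ (v∈Ny , x∉p⇒x∈∁p v∉N[C])))))
    where
    v∈Ny : v ∈ N G ⁅ y ⁆
    v∈Ny = ∈N⁺ G (v∉Cy ∘ x∈p∪q⁺ ∘ inj₂) u∈y vu
    v∉N[C] : v ∉ N[ G ] C
    v∉N[C] v∈N[C] = [ v∉NC , v∉Cy ∘ x∈p∪q⁺ ∘ inj₁ ]′ (x∈p∪q⁻ (N G C) C v∈N[C])

  N[]⊆M : ∀ {D v} → D ⊆ Cy → v ∉ Cy → v ∈ N[ G ] D → v ∈ M
  N[]⊆M {D} D⊆Cy v∉Cy v∈N[D] with x∈p∪q⁻ (N G D) D v∈N[D]
  ... | inj₁ v∈ND = let (_ , u , u∈D , vu) = ∈N⁻ G D v∈ND in neighbour⇒∈M v∉Cy (D⊆Cy u∈D) vu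
  ... | inj₂ v∈D  = contradiction (D⊆Cy v∈D) v∉Cy

  NCy⊆Cy∪M : ∀ {v} → v ∈ NCy → v ∈ Cy ⊎ v ∈ M
  NCy⊆Cy∪M {v} v∈NCy with v ∈? Cy
  ... | yes v∈Cy = inj₁ v∈Cy
  ... | no  v∉Cy = inj₂ ([ N[]⊆M (x∈p∪q⁺ ∘ inj₁) v∉Cy , N[]⊆M (x∈p∪q⁺ ∘ inj₂) v∉Cy ]′
                           (x∈p∪q⁻ (N[ G ] C) (N[ G ] ⁅ y ⁆) v∈NCy))

  M∩Cy⊆⁅x⁆ : ∀ {w} → w ∈ Cy → w ∈ M → w ≡ x
  M∩Cy⊆⁅x⁆ {w} w∈Cy w∈M with x∈p∪q⁻ (P ∪ Y) M₂ w∈M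
  ... | inj₂ w∈M₂ = contradiction w∈M₂ (NCy-disjoint-M₂ (Cy⊆NCy w∈Cy))
  ... | inj₁ w∈P∪Y with x∈p∪q⁻ P Y w∈P∪Y
  ...   | inj₂ w∈Y = contradiction w∈Cy (∉Cy w∉C w∉y)
    where
    w∉C : w ∉ C
    w∉C w∈C = x∈∁p⇒x∉p (proj₂ (x∈p∩q⁻ _ _ w∈Y)) (x∈p∪q⁺ (inj₂ w∈C))
    w∉y : w ∉ ⁅ y ⁆
    w∉y = proj₁ (∈N⁻ G ⁅ y ⁆ (proj₁ (x∈p∩q⁻ _ _ w∈Y)))
  ...   | inj₁ w∈P with x∈p∪q⁻ (N G C - y) ⁅ x ⁆ w∈P
  ...     | inj₂ w∈x = x∈⁅y⁆⇒x≡y x w∈x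
  ...     | inj₁ w∈NC-y = contradiction w∈Cy (∉Cy (proj₁ (∈N⁻ G C (p─q⊆p (N G C) ⁅ y ⁆ w∈NC-y)))
                                                       (x∈p─q⇒x∉q (N G C) ⁅ y ⁆ w∈NC-y))

  avoids-M⇒⊆Cy-x : ∀ {A c} → Connected G A → (∀ {w} → w ∈ A → w ∉ M) → c ∈ A → c ∈ Cy → A ⊆ Cy - x
  avoids-M⇒⊆Cy-x connA avoid c∈A c∈Cy = connected-trapped G connA c∈A (x∈p∧x≢y⇒x∈p-y c∈Cy c≢x) closed avoid
    where
    c≢x : _ ≢ x
    c≢x refl = avoid c∈A x∈M
    closed : ∀ {u w} → u ∈ Cy - x → adj G u w ≡ true → w ∈ Cy - x ⊎ w ∈ M
    closed {u} {w} u∈Cy-x uw with NCy⊆Cy∪M (adj-Cy⇒∈NCy (p─q⊆p Cy ⁅ x ⁆ u∈Cy-x) (trans (Graph.sym G w u) uw))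
    ... | inj₂ w∈M  = inj₂ w∈M
    ... | inj₁ w∈Cy with w ≟ x
    ...   | yes refl = inj₂ x∈M
    ...   | no  w≢x  = inj₁ (x∈p∧x≢y⇒x∈p-y w∈Cy w≢x)

  ∣Cy-x∣<t : ∣ Cy - x ∣ < t
  ∣Cy-x∣<t = subst (∣ Cy - x ∣ <_) ∣Cy∣≡t (x∈p⇒∣p-x∣<∣p∣ x∈Cy)

  no-generator-avoids-M : ∀ {A} → GenSupp G t ⊤ A → (∀ {w} → w ∈ A → w ∉ M) → ⊥
  no-generator-avoids-M {A} (_ , ∣A∣≡t , connA) avoid with nonempty? (A ∩ Cy)
  ... | yes (c , c∈A∩Cy) = <⇒≢ (≤-<-trans (p⊆q⇒∣p∣≤∣q∣ A⊆Cy-x) ∣Cy-x∣<t) ∣A∣≡t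
    where
    A⊆Cy-x = avoids-M⇒⊆Cy-x connA avoid (proj₁ (x∈p∩q⁻ A Cy c∈A∩Cy)) (proj₂ (x∈p∩q⁻ A Cy c∈A∩Cy))
  ... | no A∩Cy≢∅ with proj₂ M₂-cover A (GenSupp⇒MinGenSupp G t (A⊆W , ∣A∣≡t , connA))
    where
    A⊆W : A ⊆ W
    A⊆W a∈A = x∉p⇒x∈∁p (λ a∈NCy → [ (λ a∈Cy → A∩Cy≢∅ (_ , x∈p∩q⁺ (a∈A , a∈Cy))) , avoid a∈A ]′
                                       (NCy⊆Cy∪M a∈NCy))
  ...   | _ , v∈A , v∈M₂ = avoid v∈A (x∈p∪q⁺ (inj₂ v∈M₂))

  M-cover : Cover G t ⊤ M
  M-cover = (λ _ → ∈⊤) , covers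
    where
    covers : ∀ A → MinGenSupp G t ⊤ A → ∃ λ v → v ∈ A × v ∈ M
    covers A (gA , _) with nonempty? (A ∩ M)
    ... | yes (v , v∈A∩M) = v , x∈p∩q⁻ A M v∈A∩M
    ... | no  A∩M≢∅       = ⊥-elim (no-generator-avoids-M gA (λ w∈A w∈M → A∩M≢∅ (_ , x∈p∩q⁺ (w∈A , w∈M))))

  M∩W⊆M₂ : M ∩ W ⊆ M₂
  M∩W⊆M₂ v∈M∩W with x∈p∩q⁻ M W v∈M∩W
  ... | v∈M , v∈W = [ (λ v∈P∪Y → contradiction (P∪Y⊆NCy v∈P∪Y) (x∈∁p⇒x∉p v∈W)) , (λ v∈M₂ → v∈M₂) ]′
                      (x∈p∪q⁻ (P ∪ Y) M₂ v∈M)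

  ∣Cy∪v-x∣≡t : ∀ {v} → v ∉ Cy → ∣ (Cy ∪ ⁅ v ⁆) - x ∣ ≡ t
  ∣Cy∪v-x∣≡t {v} v∉Cy = suc-injective (begin
    suc ∣ (Cy ∪ ⁅ v ⁆) - x ∣ ≡⟨ x∈p⇒suc∣p-x∣≡∣p∣ (Cy ∪ ⁅ v ⁆) (x∈p∪q⁺ (inj₁ x∈Cy)) ⟩
    ∣ Cy ∪ ⁅ v ⁆ ∣           ≡⟨ ∣p∪q∣≡∣p∣+∣q∣ Cy ⁅ v ⁆ Cy-disjoint-v ⟩
    ∣ Cy ∣ + ∣ ⁅ v ⁆ ∣        ≡⟨ cong₂ _+_ ∣Cy∣≡t (∣⁅x⁆∣≡1 v) ⟩
    t + 1                    ≡⟨ +-comm t 1 ⟩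
    suc t                    ∎)
    where
    open ≡-Reasoning
    Cy-disjoint-v : ∀ {w} → w ∈ Cy → w ∉ ⁅ v ⁆
    Cy-disjoint-v w∈Cy w∈v = v∉Cy (subst (_∈ Cy) (x∈⁅y⁆⇒x≡y v w∈v) w∈Cy)

  module _ {M′ : Subset n} (M′-cover : Cover G t ⊤ M′) (M′⊆M : M′ ⊆ M) where

    private-vertex∈M′ : ∀ {A v} → GenSupp G t ⊤ A → (∀ {w} → w ∈ A → w ∈ M → w ≡ v) → v ∈ M′
    private-vertex∈M′ = subcover-∋-private G t M′-cover M′⊆M

    neighbour∈M′ : ∀ {u v} → v ∉ Cy → u ∈ Cy → adj G v u ≡ true → v ∈ M′
    neighbour∈M′ {u} {v} v∉Cy u∈Cy vu = private-vertex∈M′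
      ((λ _ → ∈⊤) , ∣Cy∪v-x∣≡t v∉Cy , connected-minus-simplicial G sx (connected-∪-⁅⁆ G connCy u∈Cy vu))
      only-v
      where
      only-v : ∀ {w} → w ∈ (Cy ∪ ⁅ v ⁆) - x → w ∈ M → w ≡ v
      only-v {w} w∈T-x w∈M with x∈p∪q⁻ Cy ⁅ v ⁆ (p─q⊆p (Cy ∪ ⁅ v ⁆) ⁅ x ⁆ w∈T-x)
      ... | inj₁ w∈Cy = contradiction (M∩Cy⊆⁅x⁆ w∈Cy w∈M) (x∉⁅y⁆⇒x≢y (x∈p─q⇒x∉q (Cy ∪ ⁅ v ⁆) ⁅ x ⁆ w∈T-x))
      ... | inj₂ w∈v  = x∈⁅y⁆⇒x≡y v w∈v

    P⊆M′ : P ⊆ M′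
    P⊆M′ v∈P with x∈p∪q⁻ (N G C - y) ⁅ x ⁆ v∈P
    ... | inj₂ v∈x rewrite x∈⁅y⁆⇒x≡y x v∈x = private-vertex∈M′ ((λ _ → ∈⊤) , ∣Cy∣≡t , connCy) M∩Cy⊆⁅x⁆
    ... | inj₁ v∈NC-y with ∈N⁻ G C (p─q⊆p (N G C) ⁅ y ⁆ v∈NC-y)
    ...   | v∉C , u , u∈C , vu =
      neighbour∈M′ (∉Cy v∉C (x∈p─q⇒x∉q (N G C) ⁅ y ⁆ v∈NC-y)) (x∈p∪q⁺ (inj₁ u∈C)) vu

    Y⊆M′ : Y ⊆ M′
    Y⊆M′ v∈Y with x∈p∩q⁻ (N G ⁅ y ⁆) (∁ (N[ G ] C)) v∈Y
    ... | v∈Ny , v∉N[C] with ∈N⁻ G ⁅ y ⁆ v∈Ny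
    ...   | v∉y , u , u∈y , vu =
      neighbour∈M′ (∉Cy (x∈∁p⇒x∉p v∉N[C] ∘ x∈p∪q⁺ ∘ inj₂) v∉y) (x∈p∪q⁺ (inj₂ u∈y)) vu

    M₂⊆M′ : M₂ ⊆ M′
    M₂⊆M′ {v} v∈M₂ = proj₁ (x∈p∩q⁻ M′ W (subst (v ∈_) (≡-sym M′∩W≡M₂) v∈M₂))
      where
      M′∩W⊆M₂ : M′ ∩ W ⊆ M₂
      M′∩W⊆M₂ w∈M′∩W with x∈p∩q⁻ M′ W w∈M′∩W
      ... | w∈M′ , w∈W = M∩W⊆M₂ (x∈p∩q⁺ (M′⊆M w∈M′ , w∈W))
      M′∩W≡M₂ : M′ ∩ W ≡ M₂
      M′∩W≡M₂ = proj₂ M₂-min (M′ ∩ W) (Cover-restrict G t (λ _ → ∈⊤) M′-cover) M′∩W⊆M₂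

    M⊆M′ : M ⊆ M′
    M⊆M′ v∈M = [ [ P⊆M′ , Y⊆M′ ]′ ∘ x∈p∪q⁻ P Y , M₂⊆M′ ]′ (x∈p∪q⁻ (P ∪ Y) M₂ v∈M)

  M-minimal : MinCover G t ⊤ M
  M-minimal = M-cover , λ M′ M′-cover M′⊆M → ⊆-antisym M′⊆M (M⊆M′ M′-cover M′⊆M)

  ∣M∣≡∣NC∣+∣Y∣+∣M₂∣ : ∣ M ∣ ≡ ∣ N G C ∣ + ∣ Y ∣ + ∣ M₂ ∣
  ∣M∣≡∣NC∣+∣Y∣+∣M₂∣ = begin
    ∣ (P ∪ Y) ∪ M₂ ∣         ≡⟨ ∣p∪q∣≡∣p∣+∣q∣ (P ∪ Y) M₂ (NCy-disjoint-M₂ ∘ P∪Y⊆NCy) ⟩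
    ∣ P ∪ Y ∣ + ∣ M₂ ∣       ≡⟨ cong (_+ ∣ M₂ ∣) (∣p∪q∣≡∣p∣+∣q∣ P Y P-disjoint-Y) ⟩
    ∣ P ∣ + ∣ Y ∣ + ∣ M₂ ∣   ≡⟨ cong (λ k → k + ∣ Y ∣ + ∣ M₂ ∣) ∣P∣≡∣NC∣ ⟩
    ∣ N G C ∣ + ∣ Y ∣ + ∣ M₂ ∣ ∎
    where
    open ≡-Reasoning
    P-disjoint-Y : ∀ {v} → v ∈ P → v ∉ Y
    P-disjoint-Y v∈P v∈Y = x∈∁p⇒x∉p (proj₂ (x∈p∩q⁻ (N G ⁅ y ⁆) _ v∈Y)) (P⊆N[C] v∈P)
    NC-y-disjoint-x : ∀ {v} → v ∈ N G C - y → v ∉ ⁅ x ⁆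
    NC-y-disjoint-x v∈NC-y v∈x = proj₁ (∈N⁻ G C (p─q⊆p (N G C) ⁅ y ⁆ v∈NC-y))
                                       (subst (_∈ C) (≡-sym (x∈⁅y⁆⇒x≡y x v∈x)) x∈C)
    ∣P∣≡∣NC∣ : ∣ P ∣ ≡ ∣ N G C ∣
    ∣P∣≡∣NC∣ = begin
      ∣ (N G C - y) ∪ ⁅ x ⁆ ∣    ≡⟨ ∣p∪q∣≡∣p∣+∣q∣ (N G C - y) ⁅ x ⁆ NC-y-disjoint-x ⟩
      ∣ N G C - y ∣ + ∣ ⁅ x ⁆ ∣  ≡⟨ cong (∣ N G C - y ∣ +_) (∣⁅x⁆∣≡1 x) ⟩
      ∣ N G C - y ∣ + 1          ≡⟨ +-comm ∣ N G C - y ∣ 1 ⟩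
      suc ∣ N G C - y ∣          ≡⟨ x∈p⇒suc∣p-x∣≡∣p∣ (N G C) y∈NC ⟩
      ∣ N G C ∣                  ∎

lemma4p4 : ∀ {n} (G : Graph n) (t : ℕ) → 2 ≤ t →
    (x : Fin n) → Simplicial G x →
    (C : Subset n) → x ∈ C → ∣ C ∣ ≡ t ∸ 1 → Connected G C →
    (y : Fin n) → y ∈ N G C →
    (b₁ b₂ : ℕ) → Bight G t ⊤ b₁ →
    Bight G t (∁ (N[ G ] C ∪ N[ G ] ⁅ y ⁆)) b₂ →
    ∣ N G C ∣ + ∣ N G ⁅ y ⁆ ∩ ∁ (N[ G ] C) ∣ + b₂ ≤ b₁
lemma4p4 G t 2≤t x sx C x∈C ∣C∣≡t∸1 connC y y∈NC b₁ b₂ (_ , b₁-maximal) ((M₂ , M₂-min , ∣M₂∣≡b₂) , _) =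
  subst (_≤ b₁) (trans ∣M∣≡∣NC∣+∣Y∣+∣M₂∣ (cong (_ +_) ∣M₂∣≡b₂)) (b₁-maximal ∣ M ∣ (M , M-minimal , refl))
  where open LargeMinimalCover G t 2≤t x sx C x∈C ∣C∣≡t∸1 connC y y∈NC M₂ M₂-min
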